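{- Let $\mathcal{L}=(S,\iota,\rightarrow)$ be an LTS and let $\mathsf{norm}_{\mathsf{fdr}}(\mathcal{L})=(S',\iota',\rightarrow')$ be its failures-divergences normal form. For all sequences $\rho\in\mathit{Act}^*$ and states $U\in S'$: if $\iota'\overset{\rho}{\twoheadrightarrow}{}'U$ and no state in $U$ diverges, then $\rho\notin\mathsf{divergences}(\mathcal{L})$.
   Context: Fix a finite set $\mathit{Act}$ of actions not containing the internal action $\tau$; $\mathit{Act}_\tau=\mathit{Act}\cup\{\tau\}$. An LTS is $(S,\iota,\rightarrow)$ with $\iota\in S$ and $\rightarrow\subseteq S\times\mathit{Act}_\tau\times S$. For $\sigma\in\mathit{Act}_\tau^*$, $s\overset{\sigma}{\twoheadrightarrow}t$ means there is a path from $s$ to $t$ whose labels, in order, form exactly $\sigma$ (with $s\overset{\epsilon}{\twoheadrightarrow}t$ iff $s=t$). The weak transition relation $\Longrightarrow\subseteq S\times\mathit{Act}^*\times S$ is the smallest relation with $s\overset{\epsilon}{\Longrightarrow}s$; $s\overset{\epsilon}{\Longrightarrow}t$ if $s\xrightarrow{\tau}t$; $s\overset{a}{\Longrightarrow}t$ if $s\xrightarrow{a}t$ ($a\in\mathit{Act}$); $s\overset{\rho\sigma}{\Longrightarrow}t$ if $s\overset{\rho}{\Longrightarrow}u\overset{\sigma}{\Longrightarrow}t$. A state $s$ diverges if there is an infinite sequence $s\xrightarrow{\tau}s_1\xrightarrow{\tau}s_2\xrightarrow{\tau}\cdots$. $\mathsf{divergences}(\mathcal{L})=\{\rho\sigma\in\mathit{Act}^*\mid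 \exists t: \iota\overset{\rho}{\Longrightarrow}t \text{ and } t \text{ diverges}\}$ (with $\rho,\sigma\in\mathit{Act}^*$). The failures-divergences normal form $\mathsf{norm}_{\mathsf{fdr}}(\mathcal{L})=(S',\iota',\rightarrow')$ has $S'=\mathcal{P}(S)$, $\iota'=\{s\in S\mid \iota\overset{\epsilon}{\Longrightarrow}s\}$, and for all $U,V\subseteq S$ and $a\in\mathit{Act}$: $U\xrightarrow{a}{}'V$ iff no state of $U$ diverges and $V=\{t\in S\mid \exists s\in U: s\overset{a}{\Longrightarrow}t\}$. -}

module Defs where

open import Level using (Level; _⊔_; suc; Lift)
open import Data.Empty using (⊥)
open import Data.Nat using (ℕ) renaming (suc to sucℕ)
open import Data.Fin using (Fin)
open import Data.Maybe using (Maybe; just; nothing)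
open import Data.List using (List; []; _∷_; _++_; [_])
open import Data.Product using (Σ; ∃; _×_; _,_)
open import Relation.Nullary using (¬_)
open import Relation.Binary.PropositionalEquality using (_≡_)

Act : ℕ → Set
Act n = Fin n

Actτ : ℕ → Set
Actτ n = Maybe (Act n)

τ : ∀ {n} → Actτ n
τ = nothing

record LTS (n : ℕ) (ℓ : Level) : Set (Level.suc ℓ) where
  field
    State : Set ℓ
    init  : State
    step  : State → Actτ n → State → Set ℓ
open LTS public

module _ {n : ℕ} {ℓ : Level} (L : LTS n ℓ) where

  data Path : State L → List (Actτ n) → State L → Set ℓ where
    nil  : ∀ {s} → Path s [] s
    cons : ∀ {s u t a σ} → step L s a u → Path u σ t → Path s (a ∷ σ) t

  data Weak : State L → List (Act n) → State L → Set ℓ where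
    w-refl : ∀ {s} → Weak s [] s
    w-tau  : ∀ {s t} → step L s τ t → Weak s [] t
    w-act  : ∀ {s t} (a : Act n) → step L s (just a) t → Weak s [ a ] t
    w-cat  : ∀ {s u t ρ σ} → Weak s ρ u → Weak u σ t → Weak s (ρ ++ σ) t

  Diverges : State L → Set ℓ
  Diverges s = Σ (ℕ → State L) λ f →
    (f 0 ≡ s) × (∀ i → step L (f i) τ (f (sucℕ i)))

  divergences : List (Act n) → Set ℓ
  divergences w = Σ (List (Act n)) λ ρ → Σ (List (Act n)) λ σ →
    (w ≡ ρ ++ σ) × Σ (State L) λ t → Weak (init L) ρ t × Diverges t

  Subset : Set (Level.suc ℓ)
  Subset = State L → Set ℓ

  _≐_ : Subset → Subset → Set ℓ
  U ≐ V = ∀ s → (U s → V s) × (V s → U s)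

  normInit : Subset
  normInit s = Weak (init L) [] s

  normStep : Subset → Actτ n → Subset → Set ℓ
  normStep U nothing  V = Lift ℓ ⊥
  normStep U (just a) V =
    (∀ s → U s → ¬ Diverges s) ×
    (V ≐ λ t → Σ (State L) λ s → U s × Weak s [ a ] t)

norm-fdr : ∀ {n ℓ} → LTS n ℓ → LTS n (Level.suc ℓ)
norm-fdr {ℓ = ℓ} L = record
  { State = Subset L
  ; init  = normInit L
  ; step  = λ U a V → Lift (Level.suc ℓ) (normStep L U a V)
  }

-- Call a set of states V "τ-closed" if it is closed under
-- silent weak moves, and "convergent" if none of its states diverges.
-- The initial state ι' of the normal form is τ-closed, and every target of a
-- normal-form step is τ-closed, so along any normal-form path the sets stay
-- τ-closed; by induction on weak transitions, if s ∈ V and s =ρ=> t then the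
-- normal-form path V --ρ-->> U ends in a set containing t (simulation).
-- Further, a normal-form step is only enabled from a convergent set, so the
-- source of any normal-form path into a convergent set is convergent.
-- Now suppose ρ = ρ₁σ with ι =ρ₁=> t and t diverging.  Splitting the path
-- ι' --ρ-->> U at ρ₁ gives ι' --ρ₁-->> W --σ-->> U; by simulation t ∈ W,
-- and W is convergent since U is, a contradiction.
module Submission where

open import Defs
open import Level using (Level; lift)
open import Data.Nat using (ℕ)
open import Data.Maybe using (just)
open import Data.List using (List; map; []; _∷_; _++_)
open import Data.List.Properties using (map-++)
open import Data.Product using (Σ; _×_; _,_; proj₁; proj₂)
open import Relation.Nullary using (¬_)
open import Relation.Binary.PropositionalEquality using (refl; subst)

Path-split : ∀ {n ℓ} (L : LTS n ℓ) (σ : List (Actτ n)) {σ' : List (Actτ n)} {s t : State L} →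
             Path L s (σ ++ σ') t → Σ (State L) λ u → Path L s σ u × Path L u σ' t
Path-split L []      p           = _ , nil , p
Path-split L (a ∷ σ) (cons st p) with Path-split L σ p
... | u , p₁ , p₂ = u , cons st p₁ , p₂

Path-split-visible : ∀ {n ℓ} (L : LTS n ℓ) (ρ σ : List (Act n)) {s t : State L} →
                     Path L s (map just (ρ ++ σ)) t →
                     Σ (State L) λ u → Path L s (map just ρ) u × Path L u (map just σ) t
Path-split-visible L ρ σ {s} {t} p =
  Path-split L (map just ρ) (subst (λ w → Path L s w t) (map-++ just ρ σ) p)

module _ {n : ℕ} {ℓ : Level} (L : LTS n ℓ) where

  private
    N : LTS n (Level.suc ℓ)
    N = norm-fdr L

  TauClosed : Subset L → Set ℓ
  TauClosed V = ∀ {s t} → V s → Weak L s [] t → V t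

  Convergent : Subset L → Set ℓ
  Convergent V = ∀ s → V s → ¬ Diverges L s

  normInit-tauClosed : TauClosed (normInit L)
  normInit-tauClosed ιs st = w-cat ιs st

  -- The target of a visible normal-form step is τ-closed, since it is the set
  -- of all a-successors, and =a=> followed by =ε=> is again =a=>.
  normStep-tauClosed : ∀ {V U a} → normStep L V (just a) U → TauClosed U
  normStep-tauClosed (_ , U≐) Ux st with proj₁ (U≐ _) Ux
  ... | s , Vs , s⇒x = proj₂ (U≐ _) (s , Vs , w-cat s⇒x st)

  simulate : ∀ {s ρ t} → Weak L s ρ t → ∀ {V U} → TauClosed V → V s →
             Path N V (map just ρ) U → U t × TauClosed U
  simulate w-refl          closed Vs nil = Vs , closed
  simulate (w-tau st)      closed Vs nil = closed Vs (w-tau st) , closed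
  simulate (w-act a st)    closed Vs (cons (lift step@(_ , U≐)) nil) =
    proj₂ (U≐ _) (_ , Vs , w-act a st) , normStep-tauClosed step
  simulate (w-cat {ρ = ρ} {σ = σ} p q) closed Vs path
    with Path-split-visible N ρ σ path
  ... | _ , p₁ , p₂ with simulate p closed Vs p₁
  ... | Wu , closedW = simulate q closedW Wu p₂

  -- Normal-form steps leave only convergent sets, so the source of a
  -- visible normal-form path into a convergent set is itself convergent.
  Path-source-convergent : ∀ {V U} (σ : List (Act n)) → Path N V (map just σ) U →
                           Convergent U → Convergent V
  Path-source-convergent []      nil                        convU = convU
  Path-source-convergent (a ∷ σ) (cons (lift (convV , _)) _) _    = convV

lemma3p19 : ∀ {n : ℕ} {ℓ : Level} (L : LTS n ℓ) (ρ : List (Act n)) (U : State (norm-fdr L)) →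
    Path (norm-fdr L) (init (norm-fdr L)) (map just ρ) U →
    (∀ s → U s → ¬ Diverges L s) →
    ¬ divergences L ρ
lemma3p19 L .(ρ₁ ++ σ) U path convU (ρ₁ , σ , refl , t , ι⇒t , t-div)
  with Path-split-visible (norm-fdr L) ρ₁ σ path
... | W , ι'→W , W→U with simulate L ι⇒t (normInit-tauClosed L) w-refl ι'→W
... | Wt , _ = Path-source-convergent L σ W→U convU t Wt t-div
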